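{- For $n=2$, there is a polytope with a pair of vertices $v^{(1)},v^{(2)}$ for which the unique optimal edge walk from $v^{(1)}$ to $v^{(2)}$ is backwards. Hence for this pair, $\mathcal{CD}_{efmb}\neq\mathcal{CD}_{efm}$.
   Context: For a polytope $P$, an edge walk from vertex $v^{(1)}$ to vertex $v^{(2)}$ is a sequence of vertices $v^{(1)}=y^{(0)},\dots,y^{(k)}=v^{(2)}$ with consecutive ones adjacent in the graph of $P$; write $y^{(i+1)}-y^{(i)}=\alpha_ig^i$ with $\alpha_i>0$ and $g^i$ the edge direction normalized to coprime integer components. The walk is backwards if $g^j=-g^i$ for some $i,j$, and non-backwards otherwise. $\mathcal{CD}_{efm}(v^{(1)},v^{(2)})$ is the minimum length of an edge walk (the graph distance), and $\mathcal{CD}_{efmb}$ the minimum length of a non-backwards edge walk; an optimal edge walk is one of length $\mathcal{CD}_{efm}$. -}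

module Defs where

open import Data.Nat using (ℕ; zero; suc; _∸_)
import Data.Nat
import Data.Empty
open import Data.Nat.GCD using (gcd)
open import Data.Integer using (ℤ; ∣_∣) renaming (-_ to negℤ)
open import Data.Rational using (ℚ; _+_; _*_; _-_; _/_; 0ℚ; 1ℚ; _≤_; _<_)
open import Data.Fin using (Fin; zero; suc)
open import Data.Product using (Σ; ∃; _×_; _,_)
open import Data.List using (List; []; _∷_; length)
open import Data.List.Membership.Propositional using (_∈_)
open import Relation.Binary.PropositionalEquality using (_≡_; _≢_)

Pt : Set
Pt = ℚ × ℚ

_⊕_ : Pt → Pt → Pt
(a , b) ⊕ (c , d) = (a + c , b + d)

_⊖_ : Pt → Pt → Pt
(a , b) ⊖ (c , d) = (a - c , b - d)

_·_ : ℚ → Pt → Pt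
t · (a , b) = (t * a , t * b)

dot : Pt → Pt → ℚ
dot (a , b) (c , d) = a * c + b * d

Σᶠ : (m : ℕ) → (Fin m → ℚ) → ℚ
Σᶠ zero    f = 0ℚ
Σᶠ (suc m) f = f zero + Σᶠ m (λ i → f (suc i))

Σᵖ : (m : ℕ) → (Fin m → Pt) → Pt
Σᵖ zero    f = (0ℚ , 0ℚ)
Σᵖ (suc m) f = f zero ⊕ Σᵖ m (λ i → f (suc i))

-- A polytope in the plane, given as the convex hull of finitely many points.
record Polytope : Set where
  constructor conv
  field
    m    : ℕ
    gens : Fin m → Pt

_∈P_ : Pt → Polytope → Set
x ∈P conv m p = Σ (Fin m → ℚ) λ w →
  ((i : Fin m) → 0ℚ ≤ w i) × (Σᶠ m w ≡ 1ℚ) × (x ≡ Σᵖ m (λ i → w i · p i))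

OnSegment : Pt → Pt → Pt → Set
OnSegment u w x = Σ ℚ λ t → (0ℚ ≤ t) × (t ≤ 1ℚ) × (x ≡ (t · u) ⊕ ((1ℚ - t) · w))

Vertex : Polytope → Pt → Set
Vertex P v = v ∈P P × Σ Pt λ c →
  ((x : Pt) → x ∈P P → dot c x ≤ dot c v) ×
  ((x : Pt) → x ∈P P → dot c x ≡ dot c v → x ≡ v)

Adjacent : Polytope → Pt → Pt → Set
Adjacent P u w = u ≢ w × u ∈P P × w ∈P P × Σ Pt λ c →
  (dot c u ≡ dot c w) ×
  ((x : Pt) → x ∈P P → dot c x ≤ dot c u) ×
  ((x : Pt) → x ∈P P → dot c x ≡ dot c u → OnSegment u w x)

data EdgeWalk (P : Polytope) : Pt → Pt → List Pt → Set where
  single : ∀ {u} → Vertex P u → EdgeWalk P u u (u ∷ [])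
  step   : ∀ {u x w ys} → Adjacent P u x → EdgeWalk P x w ys →
           EdgeWalk P u w (u ∷ ys)

walkLength : List Pt → ℕ
walkLength ys = length ys ∸ 1

steps : List Pt → List Pt
steps []             = []
steps (y ∷ [])       = []
steps (y ∷ z ∷ ys)   = (z ⊖ y) ∷ steps (z ∷ ys)

ℤ→ℚ : ℤ → ℚ
ℤ→ℚ z = z / 1

NormDir : Pt → ℤ × ℤ → Set
NormDir d (g₁ , g₂) = (gcd ∣ g₁ ∣ ∣ g₂ ∣ ≡ 1) ×
  Σ ℚ λ α → (0ℚ < α) × (d ≡ α · (ℤ→ℚ g₁ , ℤ→ℚ g₂))

negDir : ℤ × ℤ → ℤ × ℤ
negDir (g₁ , g₂) = (negℤ g₁ , negℤ g₂)

Backwards : List Pt → Set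
Backwards ys = Σ Pt λ d → Σ Pt λ d' → Σ (ℤ × ℤ) λ g →
  (d ∈ steps ys) × (d' ∈ steps ys) × NormDir d g × NormDir d' (negDir g)

IsCDefm : Polytope → Pt → Pt → ℕ → Set
IsCDefm P u w k =
  (Σ (List Pt) λ ys → EdgeWalk P u w ys × walkLength ys ≡ k) ×
  ((ys : List Pt) → EdgeWalk P u w ys → k Data.Nat.≤ walkLength ys)

IsCDefmb : Polytope → Pt → Pt → ℕ → Set
IsCDefmb P u w k =
  (Σ (List Pt) λ ys → EdgeWalk P u w ys × (Backwards ys → Data.Empty.⊥) × walkLength ys ≡ k) ×
  ((ys : List Pt) → EdgeWalk P u w ys → (Backwards ys → Data.Empty.⊥) → k Data.Nat.≤ walkLength ys)

module Submission where

-- Take the heptagon with corners (0,0), (0,1), (4,1), (4,0), (3,−2), (2,−3), (1,−2), in this order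
-- around the boundary, and walk from (0,0) to (4,0). Its graph is the 7-cycle: an endpoint of an edge
-- is extreme on that edge and hence a corner, and a chord cannot be an edge since the two neighbours
-- of its endpoint lie strictly on opposite sides of it. So the only walk of length 3 goes
-- up (0,1), right (1,0), down (0,−1), which is backwards, and every other walk is longer; in
-- particular a shortest non-backwards walk is strictly longer than a shortest walk.

open import Defs
open import Data.Nat using (ℕ; zero; suc; s≤s)
  renaming (_≤_ to _≤ℕ_; _<_ to _<ℕ_; _≤?_ to _≤ℕ?_; _<?_ to _<ℕ?_)
import Data.Nat
import Data.Nat.Properties as ℕ
open import Data.Integer using (ℤ; +_) renaming (-_ to -ℤ_)
open import Data.Rational using (ℚ; _+_; _*_; _-_; -_; 0ℚ; 1ℚ; _≤_; _<_; nonNegative; positive)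
open import Data.Rational.Properties
open import Data.Rational.Solver using (module +-*-Solver)
open import Data.Fin using (Fin; zero; suc)
import Data.Fin.Properties as Fin
open import Data.Product using (Σ; _×_; _,_; proj₁; proj₂)
open import Data.Product.Properties using (≡-dec)
open import Data.Sum using (_⊎_; inj₁; inj₂; map₂)
open import Data.Empty using (⊥; ⊥-elim)
open import Data.List using (List; []; _∷_)
open import Data.List.Relation.Unary.Any using (here; there)
open import Function using (_∘_)
open import Relation.Binary.Definitions using (DecidableEquality; tri<; tri≈; tri>)
open import Relation.Binary.PropositionalEquality
  using (_≡_; _≢_; refl; sym; trans; cong; cong₂; subst; module ≡-Reasoning)
open import Relation.Nullary using (yes; no; ¬?)
open import Relation.Nullary.Decidable
  using (Dec; True; False; toWitness; toWitnessFalse; from-yes; _×-dec_; _⊎-dec_; _→-dec_)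

open +-*-Solver

-- Rational arithmetic

0≤1 : 0ℚ ≤ 1ℚ
0≤1 = from-yes (0ℚ ≤? 1ℚ)

0<1 : 0ℚ < 1ℚ
0<1 = from-yes (0ℚ <? 1ℚ)

≤⇒≡⊎< : ∀ {p q} → p ≤ q → p ≡ q ⊎ p < q
≤⇒≡⊎< {p} {q} p≤q with <-cmp p q
... | tri< p<q _ _ = inj₂ p<q
... | tri≈ _ p≡q _ = inj₁ p≡q
... | tri> _ _ q<p = ⊥-elim (<-irrefl refl (<-≤-trans q<p p≤q))

*-cancelˡ-≡-pos : ∀ {r p q} → 0ℚ < r → r * p ≡ r * q → p ≡ q
*-cancelˡ-≡-pos {r} 0<r eq = ≤-antisym (*-cancelˡ-≤-pos r (≤-reflexive eq)) (*-cancelˡ-≤-pos r (≤-reflexive (sym eq)))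
  where instance _ = positive 0<r

*-monoˡ-≤-nonNeg′ : ∀ {r p q} → 0ℚ ≤ r → p ≤ q → r * p ≤ r * q
*-monoˡ-≤-nonNeg′ {r} 0≤r = *-monoˡ-≤-nonNeg r {{nonNegative 0≤r}}

+-tightˡ : ∀ {p p′ q q′} → p ≤ p′ → q ≤ q′ → p + q ≡ p′ + q′ → p ≡ p′
+-tightˡ p≤p′ q≤q′ eq with ≤⇒≡⊎< p≤p′
... | inj₁ p≡p′ = p≡p′
... | inj₂ p<p′ = ⊥-elim (<⇒≢ (+-mono-<-≤ p<p′ q≤q′) eq)

+-tightʳ : ∀ {p p′ q q′} → p ≤ p′ → q ≤ q′ → p + q ≡ p′ + q′ → q ≡ q′
+-tightʳ {p} {p′} {q} {q′} p≤p′ q≤q′ eq = +-tightˡ q≤q′ p≤p′ (trans (+-comm q p) (trans eq (+-comm p′ q′)))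

positive-combination-tight : ∀ {α β x y m} → 0ℚ < α → 0ℚ < β → x ≤ m → y ≤ m →
  α * x + β * y ≡ α * m + β * m → x ≡ m
positive-combination-tight 0<α 0<β x≤m y≤m eq =
  *-cancelˡ-≡-pos 0<α (+-tightˡ (*-monoˡ-≤-nonNeg′ (<⇒≤ 0<α) x≤m) (*-monoˡ-≤-nonNeg′ (<⇒≤ 0<β) y≤m) eq)

drop-vanishing-difference : ∀ α β γ x y a b → a ≡ b →
  α * x + β * y ≡ (α + β) * a + γ * (b - a) → α * x + β * y ≡ α * a + β * a
drop-vanishing-difference α β γ x y a b refl eq = begin
  α * x + β * y               ≡⟨ eq ⟩
  (α + β) * a + γ * (a - a)   ≡⟨ cong (λ z → (α + β) * a + γ * z) (+-inverseʳ a) ⟩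
  (α + β) * a + γ * 0ℚ        ≡⟨ cong (λ z → (α + β) * a + z) (*-zeroʳ γ) ⟩
  (α + β) * a + 0ℚ            ≡⟨ +-identityʳ ((α + β) * a) ⟩
  (α + β) * a                 ≡⟨ *-distribʳ-+ a α β ⟩
  α * a + β * a               ∎
  where open ≡-Reasoning

-- Points and segments in the plane

_≟ᵖ_ : DecidableEquality Pt
_≟ᵖ_ = ≡-dec _≟_ _≟_

cross : Pt → Pt → ℚ
cross (u₁ , u₂) (v₁ , v₂) = u₁ * v₂ - u₂ * v₁

dot-⊕ : ∀ c u v → dot c (u ⊕ v) ≡ dot c u + dot c v
dot-⊕ (c₁ , c₂) (u₁ , u₂) (v₁ , v₂) =
  solve 6 (λ c₁ c₂ u₁ u₂ v₁ v₂ → c₁ :* (u₁ :+ v₁) :+ c₂ :* (u₂ :+ v₂) := (c₁ :* u₁ :+ c₂ :* u₂) :+ (c₁ :* v₁ :+ c₂ :* v₂))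
    refl c₁ c₂ u₁ u₂ v₁ v₂

dot-· : ∀ c t u → dot c (t · u) ≡ t * dot c u
dot-· (c₁ , c₂) t (u₁ , u₂) =
  solve 5 (λ c₁ c₂ t u₁ u₂ → c₁ :* (t :* u₁) :+ c₂ :* (t :* u₂) := t :* (c₁ :* u₁ :+ c₂ :* u₂)) refl c₁ c₂ t u₁ u₂

dot-0 : ∀ c → dot c (0ℚ , 0ℚ) ≡ 0ℚ
dot-0 (c₁ , c₂) = solve 2 (λ c₁ c₂ → c₁ :* con 0ℚ :+ c₂ :* con 0ℚ := con 0ℚ) refl c₁ c₂

-- The planar identity cross v w · u = cross u w · v + cross v u · w for u = b − a, v = q − a, w = r − a,
-- paired with c.
cross-dot-identity : ∀ c a b q r →
  cross (b ⊖ a) (r ⊖ a) * dot c q + cross (q ⊖ a) (b ⊖ a) * dot c r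
    ≡ (cross (b ⊖ a) (r ⊖ a) + cross (q ⊖ a) (b ⊖ a)) * dot c a + cross (q ⊖ a) (r ⊖ a) * (dot c b - dot c a)
cross-dot-identity (c₁ , c₂) (a₁ , a₂) (b₁ , b₂) (q₁ , q₂) (r₁ , r₂) =
  solve 10 (λ c₁ c₂ a₁ a₂ b₁ b₂ q₁ q₂ r₁ r₂ →
    let u₁ = b₁ :- a₁ ; u₂ = b₂ :- a₂ ; v₁ = q₁ :- a₁ ; v₂ = q₂ :- a₂ ; w₁ = r₁ :- a₁ ; w₂ = r₂ :- a₂
        dot : _ → _ → _
        dot x y = c₁ :* x :+ c₂ :* y
    in (u₁ :* w₂ :- u₂ :* w₁) :* dot q₁ q₂ :+ (v₁ :* u₂ :- v₂ :* u₁) :* dot r₁ r₂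
       := ((u₁ :* w₂ :- u₂ :* w₁) :+ (v₁ :* u₂ :- v₂ :* u₁)) :* dot a₁ a₂
          :+ (v₁ :* w₂ :- v₂ :* w₁) :* (dot b₁ b₂ :- dot a₁ a₂))
    refl c₁ c₂ a₁ a₂ b₁ b₂ q₁ q₂ r₁ r₂

segment-degenerate : ∀ t a → (t · a) ⊕ ((1ℚ - t) · a) ≡ a
segment-degenerate t (a₁ , a₂) = cong₂ _,_ (collapse a₁) (collapse a₂)
  where
  collapse : ∀ x → t * x + (1ℚ - t) * x ≡ x
  collapse = solve 2 (λ t x → t :* x :+ (con 1ℚ :- t) :* x := x) refl t

segment-start : ∀ a b → (1ℚ · a) ⊕ ((1ℚ - 1ℚ) · b) ≡ a
segment-start (a₁ , a₂) (b₁ , b₂) = cong₂ _,_ (start a₁ b₁) (start a₂ b₂)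
  where
  start : ∀ x y → 1ℚ * x + (1ℚ - 1ℚ) * y ≡ x
  start = solve 2 (λ x y → con 1ℚ :* x :+ (con 1ℚ :- con 1ℚ) :* y := x) refl

onSegment-start : ∀ a b → OnSegment a b a
onSegment-start a b = 1ℚ , 0≤1 , ≤-refl , sym (segment-start a b)

onSegment-end : ∀ a b → OnSegment a b b
onSegment-end (a₁ , a₂) (b₁ , b₂) = 0ℚ , ≤-refl , 0≤1 , cong₂ _,_ (end a₁ b₁) (end a₂ b₂)
  where
  end : ∀ x y → y ≡ 0ℚ * x + (1ℚ - 0ℚ) * y
  end = solve 2 (λ x y → y := con 0ℚ :* x :+ (con 1ℚ :- con 0ℚ) :* y) refl

endpoint-onSegment : ∀ {a b q} → q ≡ a ⊎ q ≡ b → OnSegment a b q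
endpoint-onSegment {a} {b} (inj₁ refl) = onSegment-start a b
endpoint-onSegment {a} {b} (inj₂ refl) = onSegment-end a b

onSegment-sym : ∀ {a b q} → OnSegment a b q → OnSegment b a q
onSegment-sym {a₁ , a₂} {b₁ , b₂} (t , 0≤t , t≤1 , refl) =
  1ℚ - t , 0≤1-t , 1-t≤1 , cong₂ _,_ (swap t a₁ b₁) (swap t a₂ b₂)
  where
  swap : ∀ t x y → t * x + (1ℚ - t) * y ≡ (1ℚ - t) * y + (1ℚ - (1ℚ - t)) * x
  swap = solve 3 (λ t x y → t :* x :+ (con 1ℚ :- t) :* y := (con 1ℚ :- t) :* y :+ (con 1ℚ :- (con 1ℚ :- t)) :* x) refl
  0≤1-t : 0ℚ ≤ 1ℚ - t
  0≤1-t = subst (_≤ 1ℚ - t) (+-inverseʳ t) (+-monoˡ-≤ (- t) t≤1)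
  1-t≤1 : 1ℚ - t ≤ 1ℚ
  1-t≤1 = subst (1ℚ - t ≤_) (+-identityʳ 1ℚ) (+-monoʳ-≤ 1ℚ (neg-antimono-≤ 0≤t))

onSegment-degenerate : ∀ {a x} → OnSegment a a x → x ≡ a
onSegment-degenerate {a} (t , _ , _ , x≡) = trans x≡ (segment-degenerate t a)

onSegment⇒cross≡0 : ∀ {a b q} → OnSegment a b q → cross (q ⊖ a) (b ⊖ a) ≡ 0ℚ
onSegment⇒cross≡0 {a₁ , a₂} {b₁ , b₂} (t , _ , _ , refl) =
  solve 5 (λ t a₁ a₂ b₁ b₂ → (t :* a₁ :+ (con 1ℚ :- t) :* b₁ :- a₁) :* (b₂ :- a₂) :- (t :* a₂ :+ (con 1ℚ :- t) :* b₂ :- a₂) :* (b₁ :- a₁)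
                           := con 0ℚ)
    refl t a₁ a₂ b₁ b₂

segment-fixes-start⇒1 : ∀ t y z → t ≤ 1ℚ → y ≢ z → y ≡ (t · y) ⊕ ((1ℚ - t) · z) → t ≡ 1ℚ
segment-fixes-start⇒1 t (y₁ , y₂) (z₁ , z₂) t≤1 y≢z eq with ≤⇒≡⊎< t≤1
... | inj₁ t≡1 = t≡1
... | inj₂ t<1 = ⊥-elim (y≢z (cong₂ _,_ (coordinate y₁ z₁ (cong proj₁ eq)) (coordinate y₂ z₂ (cong proj₂ eq))))
  where
  0<1-t : 0ℚ < 1ℚ - t
  0<1-t = subst (_< 1ℚ - t) (+-inverseʳ t) (+-monoˡ-< (- t) t<1)
  coordinate : ∀ y z → y ≡ t * y + (1ℚ - t) * z → y ≡ z
  coordinate y z e = *-cancelˡ-≡-pos 0<1-t (begin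
    (1ℚ - t) * y                   ≡⟨ solve 2 (λ t y → (con 1ℚ :- t) :* y := y :- t :* y) refl t y ⟩
    y - t * y                      ≡⟨ cong (_- t * y) e ⟩
    (t * y + (1ℚ - t) * z) - t * y ≡⟨ solve 3 (λ t y z → (t :* y :+ (con 1ℚ :- t) :* z) :- t :* y := (con 1ℚ :- t) :* z) refl t y z ⟩
    (1ℚ - t) * z                   ∎)
    where open ≡-Reasoning

-- Weighted sums

dot-Σᵖ : ∀ m c (w : Fin m → ℚ) (p : Fin m → Pt) →
  dot c (Σᵖ m (λ k → w k · p k)) ≡ Σᶠ m (λ k → w k * dot c (p k))
dot-Σᵖ zero    c w p = dot-0 c
dot-Σᵖ (suc m) c w p = trans (dot-⊕ c (w zero · p zero) _)
  (cong₂ _+_ (dot-· c (w zero) (p zero)) (dot-Σᵖ m c (w ∘ suc) (p ∘ suc)))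

Σᶠ-weighted-≤ : ∀ m (w f : Fin m → ℚ) B → (∀ k → 0ℚ ≤ w k) → (∀ k → f k ≤ B) →
  Σᶠ m (λ k → w k * f k) ≤ Σᶠ m w * B
Σᶠ-weighted-≤ zero    w f B _  _  = ≤-reflexive (sym (*-zeroˡ B))
Σᶠ-weighted-≤ (suc m) w f B w≥0 f≤B = ≤-trans
  (+-mono-≤ (*-monoˡ-≤-nonNeg′ (w≥0 zero) (f≤B zero)) (Σᶠ-weighted-≤ m (w ∘ suc) (f ∘ suc) B (w≥0 ∘ suc) (f≤B ∘ suc)))
  (≤-reflexive (sym (*-distribʳ-+ B (w zero) (Σᶠ m (w ∘ suc)))))

Σᶠ-weighted-nonNeg : ∀ m (w f : Fin m → ℚ) → (∀ k → 0ℚ ≤ w k) → (∀ k → 0ℚ ≤ f k) →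
  0ℚ ≤ Σᶠ m (λ k → w k * f k)
Σᶠ-weighted-nonNeg zero    w f _   _   = ≤-refl
Σᶠ-weighted-nonNeg (suc m) w f w≥0 f≥0 = +-mono-≤
  (≤-trans (≤-reflexive (sym (*-zeroʳ (w zero)))) (*-monoˡ-≤-nonNeg′ (w≥0 zero) (f≥0 zero)))
  (Σᶠ-weighted-nonNeg m (w ∘ suc) (f ∘ suc) (w≥0 ∘ suc) (f≥0 ∘ suc))

Σᶠ-weighted-≡⇒≡ : ∀ m (w f : Fin m → ℚ) B → (∀ k → 0ℚ ≤ w k) → (∀ k → f k ≤ B) →
  Σᶠ m (λ k → w k * f k) ≡ Σᶠ m w * B → ∀ k → 0ℚ < w k → f k ≡ B
Σᶠ-weighted-≡⇒≡ (suc m) w f B w≥0 f≤B eq = go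
  where
  head≤ : w zero * f zero ≤ w zero * B
  head≤ = *-monoˡ-≤-nonNeg′ (w≥0 zero) (f≤B zero)
  tail≤ : Σᶠ m (λ k → w (suc k) * f (suc k)) ≤ Σᶠ m (w ∘ suc) * B
  tail≤ = Σᶠ-weighted-≤ m (w ∘ suc) (f ∘ suc) B (w≥0 ∘ suc) (f≤B ∘ suc)
  eq′ : w zero * f zero + Σᶠ m (λ k → w (suc k) * f (suc k)) ≡ w zero * B + Σᶠ m (w ∘ suc) * B
  eq′ = trans eq (*-distribʳ-+ B (w zero) (Σᶠ m (w ∘ suc)))
  go : ∀ k → 0ℚ < w k → f k ≡ B
  go zero    0<w = *-cancelˡ-≡-pos 0<w (+-tightˡ head≤ tail≤ eq′)
  go (suc k) 0<w = Σᶠ-weighted-≡⇒≡ m (w ∘ suc) (f ∘ suc) B (w≥0 ∘ suc) (f≤B ∘ suc) (+-tightʳ head≤ tail≤ eq′) k 0<w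

Σᶠ-convex-≤1 : ∀ m (w s : Fin m → ℚ) → (∀ k → 0ℚ ≤ w k) → Σᶠ m w ≡ 1ℚ → (∀ k → s k ≤ 1ℚ) →
  Σᶠ m (λ k → w k * s k) ≤ 1ℚ
Σᶠ-convex-≤1 m w s w≥0 Σw≡1 s≤1 =
  ≤-trans (Σᶠ-weighted-≤ m w s 1ℚ w≥0 s≤1) (≤-reflexive (trans (*-identityʳ (Σᶠ m w)) Σw≡1))

Σᶠ-pos⇒∃pos : ∀ m (w : Fin m → ℚ) → (∀ k → 0ℚ ≤ w k) → 0ℚ < Σᶠ m w → Σ (Fin m) λ k → 0ℚ < w k
Σᶠ-pos⇒∃pos zero    w _   0<0 = ⊥-elim (<-irrefl refl 0<0)
Σᶠ-pos⇒∃pos (suc m) w w≥0 0<Σ with ≤⇒≡⊎< (w≥0 zero)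
... | inj₂ 0<w₀ = zero , 0<w₀
... | inj₁ 0≡w₀ with Σᶠ-pos⇒∃pos m (w ∘ suc) (w≥0 ∘ suc)
                       (subst (0ℚ <_) (trans (cong (_+ Σᶠ m (w ∘ suc)) (sym 0≡w₀)) (+-identityˡ _)) 0<Σ)
... | k , 0<wₖ = suc k , 0<wₖ

segment-step : ∀ w₀ s₀ x a b T S → w₀ ≡ 0ℚ ⊎ x ≡ s₀ * a + (1ℚ - s₀) * b →
  w₀ * x + (T * a + (S - T) * b) ≡ (w₀ * s₀ + T) * a + ((w₀ + S) - (w₀ * s₀ + T)) * b
segment-step w₀ s₀ x a b T S (inj₁ refl) =
  solve 6 (λ s₀ x a b T S → con 0ℚ :* x :+ (T :* a :+ (S :- T) :* b)
                               := (con 0ℚ :* s₀ :+ T) :* a :+ ((con 0ℚ :+ S) :- (con 0ℚ :* s₀ :+ T)) :* b)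
    refl s₀ x a b T S
segment-step w₀ s₀ x a b T S (inj₂ refl) =
  solve 6 (λ w₀ s₀ a b T S → w₀ :* (s₀ :* a :+ (con 1ℚ :- s₀) :* b) :+ (T :* a :+ (S :- T) :* b)
                               := (w₀ :* s₀ :+ T) :* a :+ ((w₀ :+ S) :- (w₀ :* s₀ :+ T)) :* b)
    refl w₀ s₀ a b T S

Σᵖ-segment : ∀ m (w s : Fin m → ℚ) (p : Fin m → Pt) a b →
  (∀ k → w k ≡ 0ℚ ⊎ p k ≡ (s k · a) ⊕ ((1ℚ - s k) · b)) →
  Σᵖ m (λ k → w k · p k) ≡ (Σᶠ m (λ k → w k * s k) · a) ⊕ ((Σᶠ m w - Σᶠ m (λ k → w k * s k)) · b)
Σᵖ-segment zero w s p (a₁ , a₂) (b₁ , b₂) _ = cong₂ _,_ (empty a₁ b₁) (empty a₂ b₂)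
  where
  empty : ∀ x y → 0ℚ ≡ 0ℚ * x + (0ℚ - 0ℚ) * y
  empty = solve 2 (λ x y → con 0ℚ := con 0ℚ :* x :+ (con 0ℚ :- con 0ℚ) :* y) refl
Σᵖ-segment (suc m) w s p a b on
  rewrite Σᵖ-segment m (w ∘ suc) (s ∘ suc) (p ∘ suc) a b (on ∘ suc) = cong₂ _,_
    (segment-step (w zero) (s zero) _ _ _ T S (map₂ (cong proj₁) (on zero)))
    (segment-step (w zero) (s zero) _ _ _ T S (map₂ (cong proj₂) (on zero)))
  where
  T = Σᶠ m (λ k → w (suc k) * s (suc k))
  S = Σᶠ m (w ∘ suc)

Σᶠ-zero : ∀ m → Σᶠ m (λ _ → 0ℚ) ≡ 0ℚ
Σᶠ-zero zero    = refl
Σᶠ-zero (suc m) = trans (+-identityˡ _) (Σᶠ-zero m)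

Σᵖ-zero : ∀ m (p : Fin m → Pt) → Σᵖ m (λ k → 0ℚ · p k) ≡ (0ℚ , 0ℚ)
Σᵖ-zero zero    p = refl
Σᵖ-zero (suc m) p rewrite Σᵖ-zero m (p ∘ suc) = cong₂ _,_ (vanish (proj₁ (p zero))) (vanish (proj₂ (p zero)))
  where
  vanish : ∀ x → 0ℚ * x + 0ℚ ≡ 0ℚ
  vanish x = trans (+-identityʳ _) (*-zeroˡ x)

unitWeight : ∀ {m} → Fin m → Fin m → ℚ
unitWeight zero    zero    = 1ℚ
unitWeight zero    (suc _) = 0ℚ
unitWeight (suc _) zero    = 0ℚ
unitWeight (suc k) (suc j) = unitWeight k j

unitWeight-nonNeg : ∀ {m} (k j : Fin m) → 0ℚ ≤ unitWeight k j
unitWeight-nonNeg zero    zero    = 0≤1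
unitWeight-nonNeg zero    (suc _) = ≤-refl
unitWeight-nonNeg (suc _) zero    = ≤-refl
unitWeight-nonNeg (suc k) (suc j) = unitWeight-nonNeg k j

Σᶠ-unitWeight : ∀ m (k : Fin m) → Σᶠ m (unitWeight k) ≡ 1ℚ
Σᶠ-unitWeight (suc m) zero    = cong (_+_ 1ℚ) (Σᶠ-zero m)
Σᶠ-unitWeight (suc m) (suc k) = trans (+-identityˡ _) (Σᶠ-unitWeight m k)

Σᵖ-unitWeight : ∀ m (p : Fin m → Pt) (k : Fin m) → Σᵖ m (λ j → unitWeight k j · p j) ≡ p k
Σᵖ-unitWeight (suc m) p zero rewrite Σᵖ-zero m (p ∘ suc) =
  cong₂ _,_ (unit (proj₁ (p zero))) (unit (proj₂ (p zero)))
  where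
  unit : ∀ x → 1ℚ * x + 0ℚ ≡ x
  unit x = trans (+-identityʳ _) (*-identityˡ x)
Σᵖ-unitWeight (suc m) p (suc k) rewrite Σᵖ-unitWeight m (p ∘ suc) k =
  cong₂ _,_ (absorb (proj₁ (p zero)) _) (absorb (proj₂ (p zero)) _)
  where
  absorb : ∀ x y → 0ℚ * x + y ≡ y
  absorb x y = trans (cong (_+ y) (*-zeroˡ x)) (+-identityˡ y)

-- Faces of the convex hull of finitely many points

gen-∈P : ∀ m (p : Fin m → Pt) k → p k ∈P conv m p
gen-∈P m p k = unitWeight k , unitWeight-nonNeg k , Σᶠ-unitWeight m k , sym (Σᵖ-unitWeight m p k)

weights : ∀ {m p x} → x ∈P conv m p → Fin m → ℚ
weights (w , _) = w

∈P-dot-≤ : ∀ m (p : Fin m → Pt) c M {x} → x ∈P conv m p → (∀ k → dot c (p k) ≤ M) → dot c x ≤ M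
∈P-dot-≤ m p c M {x} (w , w≥0 , Σw≡1 , x≡) bound = begin
  dot c x                               ≡⟨ trans (cong (dot c) x≡) (dot-Σᵖ m c w p) ⟩
  Σᶠ m (λ k → w k * dot c (p k))        ≤⟨ Σᶠ-weighted-≤ m w (λ k → dot c (p k)) M w≥0 bound ⟩
  Σᶠ m w * M                            ≡⟨ trans (cong (_* M) Σw≡1) (*-identityˡ M) ⟩
  M                                     ∎
  where open ≤-Reasoning

∈P-dot-max⇒support : ∀ m (p : Fin m → Pt) c M {x} (mem : x ∈P conv m p) →
  (∀ k → dot c (p k) ≤ M) → dot c x ≡ M → ∀ k → 0ℚ < weights mem k → dot c (p k) ≡ M
∈P-dot-max⇒support m p c M {x} (w , w≥0 , Σw≡1 , x≡) bound x-max =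
  Σᶠ-weighted-≡⇒≡ m w (λ k → dot c (p k)) M w≥0 bound (begin
    Σᶠ m (λ k → w k * dot c (p k))  ≡⟨ dot-Σᵖ m c w p ⟨
    dot c (Σᵖ m (λ k → w k · p k))  ≡⟨ cong (dot c) x≡ ⟨
    dot c x                          ≡⟨ x-max ⟩
    M                                ≡⟨ *-identityˡ M ⟨
    1ℚ * M                           ≡⟨ cong (_* M) Σw≡1 ⟨
    Σᶠ m w * M                       ∎)
  where open ≡-Reasoning

segment-parameter : ∀ {w a b q} → 0ℚ ≤ w → (0ℚ < w → OnSegment a b q) →
  Σ ℚ λ s → (0ℚ ≤ s) × (s ≤ 1ℚ) × (w ≡ 0ℚ ⊎ q ≡ (s · a) ⊕ ((1ℚ - s) · b))
segment-parameter 0≤w on with ≤⇒≡⊎< 0≤w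
... | inj₁ 0≡w = 0ℚ , ≤-refl , 0≤1 , inj₁ (sym 0≡w)
... | inj₂ 0<w with on 0<w
... | s , 0≤s , s≤1 , q≡ = s , 0≤s , s≤1 , inj₂ q≡

segment-parameters : ∀ m (w : Fin m → ℚ) (p : Fin m → Pt) a b → (∀ k → 0ℚ ≤ w k) →
  (∀ k → 0ℚ < w k → OnSegment a b (p k)) →
  Σ (Fin m → ℚ) λ s → (∀ k → 0ℚ ≤ s k) × (∀ k → s k ≤ 1ℚ) ×
                      (∀ k → w k ≡ 0ℚ ⊎ p k ≡ (s k · a) ⊕ ((1ℚ - s k) · b))
segment-parameters m w p a b w≥0 on =
  proj₁ ∘ param , proj₁ ∘ proj₂ ∘ param , proj₁ ∘ proj₂ ∘ proj₂ ∘ param , proj₂ ∘ proj₂ ∘ proj₂ ∘ param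
  where
  param : ∀ k → Σ ℚ λ s → (0ℚ ≤ s) × (s ≤ 1ℚ) × (w k ≡ 0ℚ ⊎ p k ≡ (s · a) ⊕ ((1ℚ - s) · b))
  param k = segment-parameter (w≥0 k) (on k)

∈P-onSegment : ∀ m (p : Fin m → Pt) a b {x} (mem : x ∈P conv m p) →
  (∀ k → 0ℚ < weights mem k → OnSegment a b (p k)) → OnSegment a b x
∈P-onSegment m p a b {x} (w , w≥0 , Σw≡1 , x≡) on with segment-parameters m w p a b w≥0 on
... | s , s≥0 , s≤1 , split =
  T , Σᶠ-weighted-nonNeg m w s w≥0 s≥0 , Σᶠ-convex-≤1 m w s w≥0 Σw≡1 s≤1 ,
  trans x≡ (trans (Σᵖ-segment m w s p a b split) (cong (λ S → (T · a) ⊕ ((S - T) · b)) Σw≡1))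
  where T = Σᶠ m (λ k → w k * s k)

vertex-certificate : ∀ m (p : Fin m → Pt) v c → v ∈P conv m p → (∀ k → dot c (p k) ≤ dot c v) →
  (∀ k → dot c (p k) ≡ dot c v → p k ≡ v) → Vertex (conv m p) v
vertex-certificate m p v c v∈P bound unique = v∈P , c , (λ x x∈P → ∈P-dot-≤ m p c (dot c v) {x} x∈P bound) , only-v
  where
  only-v : (x : Pt) → x ∈P conv m p → dot c x ≡ dot c v → x ≡ v
  only-v x x∈P x-max = onSegment-degenerate (∈P-onSegment m p v v {x} x∈P (λ k 0<w →
      subst (OnSegment v v) (sym (unique k (∈P-dot-max⇒support m p c (dot c v) {x} x∈P bound x-max k 0<w))) (onSegment-start v v)))

edge-certificate : ∀ m (p : Fin m → Pt) a b c → a ≢ b → a ∈P conv m p → b ∈P conv m p →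
  dot c a ≡ dot c b → (∀ k → dot c (p k) ≤ dot c a) →
  (∀ k → dot c (p k) ≡ dot c a → OnSegment a b (p k)) → Adjacent (conv m p) a b
edge-certificate m p a b c a≢b a∈P b∈P level bound face =
  a≢b , a∈P , b∈P , c , level , (λ _ x∈P → ∈P-dot-≤ m p c (dot c a) x∈P bound) ,
  λ x x∈P x-max → ∈P-onSegment m p a b x∈P λ k 0<w → face k (∈P-dot-max⇒support m p c (dot c a) x∈P bound x-max k 0<w)

-- y is a convex combination of generators lying on [y, z]; since y ≠ z, this forces all the
-- weight onto the end y of the segment, so some generator equals y.
edge-endpoint-generator : ∀ m (p : Fin m → Pt) c y z → y ≢ z → y ∈P conv m p →
  (∀ k → dot c (p k) ≤ dot c y) → (∀ k → dot c (p k) ≡ dot c y → OnSegment y z (p k)) →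
  Σ (Fin m) λ k → y ≡ p k
edge-endpoint-generator m p c y z y≢z mem@(w , w≥0 , Σw≡1 , y≡) bound face
  with segment-parameters m w p y z w≥0 (λ k 0<w → face k (∈P-dot-max⇒support m p c (dot c y) mem bound refl k 0<w))
... | s , _ , s≤1 , split with Σᶠ-pos⇒∃pos m w w≥0 (subst (0ℚ <_) (sym Σw≡1) 0<1)
... | k , 0<wₖ = k , sym (generator (split k))
  where
  T = Σᶠ m (λ k → w k * s k)
  T≡1 : T ≡ 1ℚ
  T≡1 = segment-fixes-start⇒1 T y z (Σᶠ-convex-≤1 m w s w≥0 Σw≡1 s≤1) y≢z
    (trans y≡ (trans (Σᵖ-segment m w s p y z split) (cong (λ S → (T · y) ⊕ ((S - T) · z)) Σw≡1)))
  sₖ≡1 : s k ≡ 1ℚ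
  sₖ≡1 = Σᶠ-weighted-≡⇒≡ m w s 1ℚ w≥0 s≤1 (trans T≡1 (sym (cong (_* 1ℚ) Σw≡1))) k 0<wₖ
  generator : w k ≡ 0ℚ ⊎ p k ≡ (s k · y) ⊕ ((1ℚ - s k) · z) → p k ≡ y
  generator (inj₁ wₖ≡0) = ⊥-elim (<⇒≢ 0<wₖ (sym wₖ≡0))
  generator (inj₂ pₖ≡) = trans pₖ≡ (trans (cong (λ t → (t · y) ⊕ ((1ℚ - t) · z)) sₖ≡1) (segment-start y z))

-- q and r lie strictly on opposite sides of the line ab, so no supporting line of P can pass
-- through a and b: the cross products give a positive combination of q − a and r − a parallel to b − a.
opposite-sides⇒¬edge : ∀ c a b q r → dot c a ≡ dot c b → dot c q ≤ dot c a → dot c r ≤ dot c a →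
  (dot c q ≡ dot c a → OnSegment a b q) →
  0ℚ < cross (b ⊖ a) (r ⊖ a) → 0ℚ < cross (q ⊖ a) (b ⊖ a) → ⊥
opposite-sides⇒¬edge c a b q r level q≤ r≤ face 0<α 0<β =
  <⇒≢ 0<β (sym (onSegment⇒cross≡0 (face (positive-combination-tight 0<α 0<β q≤ r≤
    (drop-vanishing-difference (cross (b ⊖ a) (r ⊖ a)) (cross (q ⊖ a) (b ⊖ a)) (cross (q ⊖ a) (r ⊖ a))
                  (dot c q) (dot c r) (dot c a) (dot c b) level (cross-dot-identity c a b q r))))))

walkLength-step : ∀ {P x w ys} u → EdgeWalk P x w ys → walkLength (u ∷ ys) ≡ suc (walkLength ys)
walkLength-step u (single _) = refl
walkLength-step u (step _ _) = refl

unique-backwards-optimum⇒CD≢ : ∀ {P u v W} → EdgeWalk P u v W →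
  (∀ ys → EdgeWalk P u v ys → walkLength W ≤ℕ walkLength ys) →
  (∀ ys → EdgeWalk P u v ys → walkLength ys ≡ walkLength W → ys ≡ W) →
  Backwards W → ∀ k k′ → IsCDefm P u v k → IsCDefmb P u v k′ → k ≢ k′
unique-backwards-optimum⇒CD≢ {W = W} walk optimal unique backwards k k′
  (_ , k-min) ((zs , zs-walk , zs-forward , zs-len) , _) refl =
  zs-forward (subst Backwards (sym (unique zs zs-walk zs≡W-length)) backwards)
  where
  zs≡W-length : walkLength zs ≡ walkLength W
  zs≡W-length = ℕ.≤-antisym (subst (_≤ℕ walkLength W) (sym zs-len) (k-min W walk)) (optimal zs zs-walk)

-- The heptagon

pattern c₀ = zero
pattern c₁ = suc c₀
pattern c₂ = suc c₁
pattern c₃ = suc c₂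
pattern c₄ = suc c₃
pattern c₅ = suc c₄
pattern c₆ = suc c₅

pt : ℤ → ℤ → Pt
pt x y = ℤ→ℚ x , ℤ→ℚ y

corner : Fin 7 → Pt
corner c₀ = pt (+ 0) (+ 0)
corner c₁ = pt (+ 0) (+ 1)
corner c₂ = pt (+ 4) (+ 1)
corner c₃ = pt (+ 4) (+ 0)
corner c₄ = pt (+ 3) (-ℤ + 2)
corner c₅ = pt (+ 2) (-ℤ + 3)
corner c₆ = pt (+ 1) (-ℤ + 2)

heptagon : Polytope
heptagon = conv 7 corner

corner-∈ : ∀ k → corner k ∈P heptagon
corner-∈ = gen-∈P 7 corner

corner-vertex : ∀ i c →
  {True (Fin.all? λ k → dot c (corner k) ≤? dot c (corner i))} →
  {True (Fin.all? λ k → (dot c (corner k) ≟ dot c (corner i)) →-dec (corner k ≟ᵖ corner i))} →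
  Vertex heptagon (corner i)
corner-vertex i c {max} {unique} =
  vertex-certificate 7 corner (corner i) c (corner-∈ i) (toWitness max) (toWitness unique)

corner-edge : ∀ i j c → {False (corner i ≟ᵖ corner j)} →
  {True (dot c (corner i) ≟ dot c (corner j))} →
  {True (Fin.all? λ k → dot c (corner k) ≤? dot c (corner i))} →
  {True (Fin.all? λ k → (dot c (corner k) ≟ dot c (corner i)) →-dec (corner k ≟ᵖ corner i ⊎-dec corner k ≟ᵖ corner j))} →
  Adjacent heptagon (corner i) (corner j)
corner-edge i j c {distinct} {level} {max} {ends} =
  edge-certificate 7 corner (corner i) (corner j) c (toWitnessFalse distinct) (corner-∈ i) (corner-∈ j)
    (toWitness level) (toWitness max) (λ k on-line → endpoint-onSegment (toWitness ends k on-line))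

next prev : Fin 7 → Fin 7
next c₀ = c₁
next c₁ = c₂
next c₂ = c₃
next c₃ = c₄
next c₄ = c₅
next c₅ = c₆
next c₆ = c₀
prev c₀ = c₆
prev c₁ = c₀
prev c₂ = c₁
prev c₃ = c₂
prev c₄ = c₃
prev c₅ = c₄
prev c₆ = c₅

Neighbour : Fin 7 → Fin 7 → Set
Neighbour i j = j ≡ next i ⊎ j ≡ prev i

neighbour? : ∀ i j → Dec (Neighbour i j)
neighbour? i j = (j Fin.≟ next i) ⊎-dec (j Fin.≟ prev i)

-- A chord from corner i leaves its two neighbours on opposite sides.
chord-separates : ∀ i j → j ≢ i → j ≢ next i → j ≢ prev i →
  0ℚ < cross (corner j ⊖ corner i) (corner (next i) ⊖ corner i) ×
  0ℚ < cross (corner (prev i) ⊖ corner i) (corner j ⊖ corner i)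
chord-separates = from-yes (Fin.all? λ i → Fin.all? λ j →
  ¬? (j Fin.≟ i) →-dec ¬? (j Fin.≟ next i) →-dec ¬? (j Fin.≟ prev i) →-dec
  (0ℚ <? cross (corner j ⊖ corner i) (corner (next i) ⊖ corner i)) ×-dec
  (0ℚ <? cross (corner (prev i) ⊖ corner i) (corner j ⊖ corner i)))

adjacent-corners⇒neighbour : ∀ i j → Adjacent heptagon (corner i) (corner j) → Neighbour i j
adjacent-corners⇒neighbour i j (i≢j , _ , _ , c , level , bound , face)
  with j Fin.≟ next i | j Fin.≟ prev i | j Fin.≟ i
... | yes j≡next | _          | _       = inj₁ j≡next
... | no _       | yes j≡prev | _       = inj₂ j≡prev
... | no _       | no _       | yes refl = ⊥-elim (i≢j refl)
... | no j≢next  | no j≢prev  | no j≢i  =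
  let 0<α , 0<β = chord-separates i j j≢i j≢next j≢prev in
  ⊥-elim (opposite-sides⇒¬edge c (corner i) (corner j) (corner (prev i)) (corner (next i)) level
    (bound _ (corner-∈ (prev i))) (bound _ (corner-∈ (next i))) (face _ (corner-∈ (prev i))) 0<α 0<β)

adjacent-corner : ∀ i {x} → Adjacent heptagon (corner i) x → Σ (Fin 7) λ j → x ≡ corner j × Neighbour i j
adjacent-corner i {x} adj@(i≢x , _ , x∈P , c , level , bound , face) =
  j , x≡j , adjacent-corners⇒neighbour i j (subst (Adjacent heptagon (corner i)) x≡j adj)
  where
  endpoint = edge-endpoint-generator 7 corner c x (corner i) (i≢x ∘ sym) x∈P
    (λ k → ≤-trans (bound _ (corner-∈ k)) (≤-reflexive level))
    (λ k on-line → onSegment-sym (face _ (corner-∈ k) (trans on-line (sym level))))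
  j = proj₁ endpoint
  x≡j = proj₂ endpoint

dist : Fin 7 → ℕ
dist c₀ = 3
dist c₁ = 2
dist c₂ = 1
dist c₃ = 0
dist c₄ = 1
dist c₅ = 2
dist c₆ = 3

down : Fin 7 → Fin 7
down c₀ = c₁
down c₁ = c₂
down c₂ = c₃
down c₃ = c₃
down c₄ = c₃
down c₅ = c₄
down c₆ = c₅

dist-target : ∀ i → corner i ≡ corner c₃ → dist i ≡ 0
dist-target = from-yes (Fin.all? λ i → (corner i ≟ᵖ corner c₃) →-dec (dist i ℕ.≟ 0))

dist-neighbour : ∀ i j → Neighbour i j → dist i ≤ℕ suc (dist j)
dist-neighbour = from-yes (Fin.all? λ i → Fin.all? λ j → neighbour? i j →-dec (dist i ≤ℕ? suc (dist j)))

dist-descent : ∀ i j → Neighbour i j → dist j <ℕ dist i → j ≡ down i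
dist-descent = from-yes (Fin.all? λ i → Fin.all? λ j → neighbour? i j →-dec (dist j <ℕ? dist i) →-dec (j Fin.≟ down i))

dist≤walkLength : ∀ {u ys} i → u ≡ corner i → EdgeWalk heptagon u (corner c₃) ys → dist i ≤ℕ walkLength ys
dist≤walkLength i u≡i (single _) = ℕ.≤-reflexive (dist-target i (sym u≡i))
dist≤walkLength {u} i refl (step adj rest) =
  let j , x≡j , i~j = adjacent-corner i adj in
  ℕ.≤-trans (dist-neighbour i j i~j)
    (subst (suc (dist j) ≤ℕ_) (sym (walkLength-step u rest)) (s≤s (dist≤walkLength j x≡j rest)))

geodesic : ℕ → Fin 7 → List Pt
geodesic zero    i = corner i ∷ []
geodesic (suc n) i = corner i ∷ geodesic n (down i)

-- Each step of a walk of length dist i has to decrease dist, and down i is the only neighbour doing so.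
walk-of-length-dist≡geodesic : ∀ {u ys} i n → u ≡ corner i → dist i ≡ n →
  EdgeWalk heptagon u (corner c₃) ys → walkLength ys ≡ n → ys ≡ geodesic n i
walk-of-length-dist≡geodesic i zero    u≡i _ (single _) _ = cong (_∷ []) u≡i
walk-of-length-dist≡geodesic i (suc n) _   _ (single _) ()
walk-of-length-dist≡geodesic {u} i zero _ _ (step _ rest) len with () ← trans (sym (walkLength-step u rest)) len
walk-of-length-dist≡geodesic {u} i (suc n) refl dist≡ (step {ys = ys} adj rest) len =
  cong (corner i ∷_) (trans (walk-of-length-dist≡geodesic j n x≡j dist-j≡n rest len′) (cong (geodesic n) j≡down))
  where
  neighbour = adjacent-corner i adj
  j = proj₁ neighbour
  x≡j = proj₁ (proj₂ neighbour)
  i~j = proj₂ (proj₂ neighbour)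
  len′ : walkLength ys ≡ n
  len′ = ℕ.suc-injective (trans (sym (walkLength-step u rest)) len)
  dist-j≤n : dist j ≤ℕ n
  dist-j≤n = subst (dist j ≤ℕ_) len′ (dist≤walkLength j x≡j rest)
  j≡down : j ≡ down i
  j≡down = dist-descent i j i~j (subst (dist j <ℕ_) (sym dist≡) (s≤s dist-j≤n))
  dist-j≡n : dist j ≡ n
  dist-j≡n = ℕ.≤-antisym dist-j≤n (ℕ.≤-pred (subst (_≤ℕ suc (dist j)) dist≡ (dist-neighbour i j i~j)))

shortest-walk : EdgeWalk heptagon (corner c₀) (corner c₃) (geodesic 3 c₀)
shortest-walk =
  step (corner-edge c₀ c₁ (pt (-ℤ + 1) (+ 0))) (step (corner-edge c₁ c₂ (pt (+ 0) (+ 1)))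
    (step (corner-edge c₂ c₃ (pt (+ 1) (+ 0))) (single (corner-vertex c₃ (pt (+ 3) (-ℤ + 1))))))

shortest-walk-backwards : Backwards (geodesic 3 c₀)
shortest-walk-backwards =
  corner c₁ ⊖ corner c₀ , corner c₃ ⊖ corner c₂ , (+ 0 , + 1) , here refl , there (there (here refl)) ,
  (refl , 1ℚ , 0<1 , refl) , (refl , 1ℚ , 0<1 , refl)

lemma7 : Σ Polytope λ P → Σ Pt λ v₁ → Σ Pt λ v₂ → Σ (List Pt) λ W →
    Vertex P v₁ × Vertex P v₂ ×
    EdgeWalk P v₁ v₂ W ×
    ((ys : List Pt) → EdgeWalk P v₁ v₂ ys → walkLength W Data.Nat.≤ walkLength ys) ×
    ((ys : List Pt) → EdgeWalk P v₁ v₂ ys → walkLength ys ≡ walkLength W → ys ≡ W) ×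
    Backwards W ×
    ((k k' : ℕ) → IsCDefm P v₁ v₂ k → IsCDefmb P v₁ v₂ k' → k ≢ k')
lemma7 = heptagon , corner c₀ , corner c₃ , geodesic 3 c₀ ,
  corner-vertex c₀ (pt (-ℤ + 3) (-ℤ + 1)) , corner-vertex c₃ (pt (+ 3) (-ℤ + 1)) ,
  shortest-walk , optimal , unique , shortest-walk-backwards ,
  unique-backwards-optimum⇒CD≢ shortest-walk optimal unique shortest-walk-backwards
  where
  optimal : ∀ ys → EdgeWalk heptagon (corner c₀) (corner c₃) ys → 3 ≤ℕ walkLength ys
  optimal ys = dist≤walkLength c₀ refl
  unique : ∀ ys → EdgeWalk heptagon (corner c₀) (corner c₃) ys → walkLength ys ≡ 3 → ys ≡ geodesic 3 c₀
  unique ys = walk-of-length-dist≡geodesic c₀ 3 refl refl
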